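{- Let $u,r\ge 1$ be integers and let $S_1,S_2$ be (possibly empty) words in the letters $R,U$. Let $$\omega=S_1\,R\,\underbrace{U\cdots U}_{u}\underbrace{R\cdots R}_{r}\,U\,S_2,\qquad \omega'=S_1\underbrace{R\cdots R}_{r+1}\underbrace{U\cdots U}_{u+1}S_2.$$ Then $M(\omega')\ge M(\omega)$, and equality holds only if $S_1$ is empty or $S_1$ is the single letter $U$.
   Context: For a word $W=w_1\cdots w_n$ in the letters $R,U$, let $f(W)=[a_0,\ldots,a_t]$ be the finite continued fraction whose entry sequence is obtained by scanning $i=1,\ldots,n-1$ in order and appending $1,1$ if $w_i=w_{i+1}$ and $2$ if $w_i\ne w_{i+1}$. The numerator of a finite continued fraction $[c_0,\ldots,c_t]$ is $p_t$ where $p_{ -2}=0,p_{ -1}=1,p_i=c_ip_{i-1}+p_{i-2}$. $M(W)$ denotes the numerator of $f(W)$ (equivalently, the number of perfect matchings of the snake graph associated to the lattice path $W$). -}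

module Defs where

open import Data.Nat using (ℕ; zero; suc; _+_; _*_)
open import Data.List using (List; []; _∷_; _++_; replicate)
open import Data.Product using (_×_; _,_)

data Letter : Set where
  R U : Letter

Word : Set
Word = List Letter

entries : Letter → Letter → List ℕ
entries R R = 1 ∷ 1 ∷ []
entries U U = 1 ∷ 1 ∷ []
entries R U = 2 ∷ []
entries U R = 2 ∷ []

f : Word → List ℕ
f [] = []
f (a ∷ []) = []
f (a ∷ b ∷ w) = entries a b ++ f (b ∷ w)

-- numerator of [c_0,...,c_t]: p_{-2}=0, p_{-1}=1, p_i = c_i p_{i-1} + p_{i-2}
-- numAux cs (p_{i-1} , p_{i-2}) processes cs left to right; returns p_t
numAux : List ℕ → ℕ → ℕ → ℕ
numAux [] p₁ p₂ = p₁
numAux (c ∷ cs) p₁ p₂ = numAux cs (c * p₁ + p₂) p₁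

numerator : List ℕ → ℕ
numerator cs = numAux cs 1 0

M : Word → ℕ
M W = numerator (f W)

ω : Word → ℕ → ℕ → Word → Word
ω S₁ u r S₂ = S₁ ++ (R ∷ replicate u U ++ replicate r R ++ U ∷ S₂)

ω′ : Word → ℕ → ℕ → Word → Word
ω′ S₁ u r S₂ = S₁ ++ (replicate (suc r) R ++ replicate (suc u) U ++ S₂)

{-# OPTIONS --safe #-}
module Submission where

-- Since numAux is linear in its initial pair, splitting f at the first R of the changed block gives
-- M = κ · m ℓ, where ℓ is the convergent pair of the entries before that R, κ = (α , β) the
-- coefficient pair of the entries f (U ∷ S₂) after the block, and m the action of the entries in
-- between. A run of n entry pairs 1, 1 acts by the matrix [[F₂ₙ₊₁, F₂ₙ], [F₂ₙ, F₂ₙ₋₁]], and a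
-- polynomial identity in these entries gives M(ω′) = M(ω) + 2 F₂ᵤ F₂ᵣ (ℓ₂ α + (ℓ₁ + ℓ₂) β).
-- The excess is positive once S₁ is nonempty (then ℓ₂ ≥ 1), so equality even forces S₁ = [].

open import Defs
open import Data.Nat using (ℕ; zero; suc; _+_; _*_; _≤_; _≥_; z≤n; s≤s)
open import Data.Nat.Properties using (≤-trans; ≤-reflexive; m≤m+n; m≤n+m; m<m+n; <-irrefl; *-mono-≤)
open import Data.Nat.Tactic.RingSolver using (solve-∀)
open import Data.List using (List; []; _∷_; _++_; replicate)
open import Data.List.Properties using (++-assoc; ++-identityʳ)
open import Data.Product using (_×_; _,_; proj₁; proj₂; uncurry; ∃₂)
open import Data.Sum using (_⊎_; inj₁)
open import Data.Empty using (⊥-elim)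
open import Relation.Binary.PropositionalEquality using (_≡_; refl; sym; trans; cong; cong₂; module ≡-Reasoning)

Pair : Set
Pair = ℕ × ℕ

step : ℕ → Pair → Pair
step c (p , q) = c * p + q , p

run : List ℕ → Pair → Pair
run []       v = v
run (c ∷ cs) v = run cs (step c v)

convergentPair : List ℕ → Pair
convergentPair cs = run cs (1 , 0)

coeffs : List ℕ → Pair
coeffs cs = numAux cs 1 0 , numAux cs 0 1

infix 7 _·_
_·_ : Pair → Pair → ℕ
(α , β) · (p , q) = α * p + β * q

numAux-++ : ∀ xs ys p q → numAux (xs ++ ys) p q ≡ uncurry (numAux ys) (run xs (p , q))
numAux-++ []       ys p q = refl
numAux-++ (c ∷ xs) ys p q = numAux-++ xs ys (c * p + q) p

numAux-linear : ∀ cs p q → numAux cs p q ≡ coeffs cs · (p , q)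
numAux-linear []       p q = unit-coeffs p q
  where
  unit-coeffs : ∀ p q → p ≡ 1 * p + 0 * q
  unit-coeffs = solve-∀
numAux-linear (c ∷ cs) p q = begin
  numAux cs (c * p + q) p
    ≡⟨ numAux-linear cs (c * p + q) p ⟩
  A * (c * p + q) + B * p
    ≡⟨ regroup c p q A B ⟩
  (A * (c * 1 + 0) + B * 1) * p + (A * (c * 0 + 1) + B * 0) * q
    ≡⟨ sym (cong₂ (λ x y → x * p + y * q) (numAux-linear cs (c * 1 + 0) 1)
                                           (numAux-linear cs (c * 0 + 1) 0)) ⟩
  coeffs (c ∷ cs) · (p , q) ∎
  where
  open ≡-Reasoning
  A = numAux cs 1 0
  B = numAux cs 0 1
  regroup : ∀ c p q A B → A * (c * p + q) + B * p
          ≡ (A * (c * 1 + 0) + B * 1) * p + (A * (c * 0 + 1) + B * 0) * q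
  regroup = solve-∀

numAux-positive : ∀ cs {p q} → 1 ≤ p → 1 ≤ q → 1 ≤ numAux cs p q
numAux-positive []       p≥1 q≥1 = p≥1
numAux-positive (c ∷ cs) {p} {q} p≥1 q≥1 =
  numAux-positive cs (≤-trans q≥1 (m≤n+m q (c * p))) p≥1

proj₂-run-positive : ∀ cs {p q} → 1 ≤ p → 1 ≤ q → 1 ≤ proj₂ (run cs (p , q))
proj₂-run-positive []       p≥1 q≥1 = q≥1
proj₂-run-positive (c ∷ cs) {p} {q} p≥1 q≥1 =
  proj₂-run-positive cs (≤-trans q≥1 (m≤n+m q (c * p))) p≥1

entries-diag : ∀ a → entries a a ≡ 1 ∷ 1 ∷ []
entries-diag R = refl
entries-diag U = refl

f-++ : ∀ S a w → f (S ++ a ∷ w) ≡ f (S ++ a ∷ []) ++ f (a ∷ w)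
f-++ []          a w = refl
f-++ (x ∷ [])    a w = cong (_++ f (a ∷ w)) (sym (++-identityʳ (entries x a)))
f-++ (x ∷ y ∷ s) a w = trans (cong (entries x y ++_) (f-++ (y ∷ s) a w))
                             (sym (++-assoc (entries x y) (f (y ∷ s ++ a ∷ [])) (f (a ∷ w))))

ones : ℕ → List ℕ
ones zero    = []
ones (suc n) = 1 ∷ 1 ∷ ones n

f-replicate : ∀ a n w → f (a ∷ replicate n a ++ w) ≡ ones n ++ f (a ∷ w)
f-replicate a zero    w = refl
f-replicate a (suc n) w = cong₂ _++_ (entries-diag a) (f-replicate a n w)

f-head : ∀ x y w → ∃₂ λ c cs → f (x ∷ y ∷ w) ≡ suc c ∷ cs
f-head R R w = _ , _ , refl
f-head R U w = _ , _ , refl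
f-head U R w = _ , _ , refl
f-head U U w = _ , _ , refl

-- fibEven n = F₂ₙ and fibOdd n = F₂ₙ₋₁ (Fibonacci numbers, with F₋₁ = 1).
mutual
  fibEven : ℕ → ℕ
  fibEven zero    = 0
  fibEven (suc n) = 2 * fibEven n + fibOdd n

  fibOdd : ℕ → ℕ
  fibOdd zero    = 1
  fibOdd (suc n) = fibEven n + fibOdd n

fibOdd-positive : ∀ n → 1 ≤ fibOdd n
fibOdd-positive zero    = s≤s z≤n
fibOdd-positive (suc n) = ≤-trans (fibOdd-positive n) (m≤n+m (fibOdd n) (fibEven n))

fibEven-suc-positive : ∀ n → 1 ≤ fibEven (suc n)
fibEven-suc-positive n = ≤-trans (fibOdd-positive n) (m≤n+m (fibOdd n) (2 * fibEven n))

block : ℕ → ℕ → Pair → Pair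
block b c (p , q) = p * (b + c) + q * b , p * b + q * c

fibBlock : ℕ → Pair → Pair
fibBlock n = block (fibEven n) (fibOdd n)

numAux-ones : ∀ n cs p q → numAux (ones n ++ cs) p q ≡ uncurry (numAux cs) (fibBlock n (p , q))
numAux-ones zero    cs p q = cong₂ (numAux cs) (unit₁ p q) (unit₂ p q)
  where
  unit₁ : ∀ p q → p ≡ p * (0 + 1) + q * 0
  unit₁ = solve-∀
  unit₂ : ∀ p q → q ≡ p * 0 + q * 1
  unit₂ = solve-∀
numAux-ones (suc n) cs p q =
  trans (numAux-ones n cs (1 * (1 * p + q) + p) (1 * p + q))
        (cong₂ (numAux cs) (shift₁ p q (fibEven n) (fibOdd n)) (shift₂ p q (fibEven n) (fibOdd n)))
  where
  shift₁ : ∀ p q b c → (1 * (1 * p + q) + p) * (b + c) + (1 * p + q) * b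
         ≡ p * ((2 * b + c) + (b + c)) + q * (2 * b + c)
  shift₁ = solve-∀
  shift₂ : ∀ p q b c → (1 * (1 * p + q) + p) * b + (1 * p + q) * c
         ≡ p * (2 * b + c) + q * (b + c)
  shift₂ = solve-∀

middleω : ℕ → ℕ → ℕ → ℕ → Pair → Pair
middleω b c b′ c′ v = step 2 (block b′ c′ (step 2 (block b c (step 2 v))))

middleω′ : ℕ → ℕ → ℕ → ℕ → Pair → Pair
middleω′ b c b′ c′ v = block b c (step 1 (step 1 (step 2 (block b′ c′ (step 1 (step 1 v))))))

middle-exchange : ∀ b c b′ c′ α β l₁ l₂ →
  (α , β) · middleω′ b c b′ c′ (l₁ , l₂)
    ≡ (α , β) · middleω b c b′ c′ (l₁ , l₂)
      + 2 * (2 * b + c) * (2 * b′ + c′) * (l₂ * α + (l₁ + l₂) * β)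
middle-exchange = unfolded
  where
  -- solve-∀ does not unfold step and block, so it is handed the identity with both unfolded.
  unfolded : ∀ b c b′ c′ α β l₁ l₂ →
      α * ((1 * (1 * (2 * ((1 * (1 * l₁ + l₂) + l₁) * (b′ + c′) + (1 * l₁ + l₂) * b′) + ((1 * (1
          * l₁ + l₂) + l₁) * b′ + (1 * l₁ + l₂) * c′)) + ((1 * (1 * l₁ + l₂) + l₁) * (b′ + c′) +
          (1 * l₁ + l₂) * b′)) + (2 * ((1 * (1 * l₁ + l₂) + l₁) * (b′ + c′) + (1 * l₁ + l₂) * b′)
          + ((1 * (1 * l₁ + l₂) + l₁) * b′ + (1 * l₁ + l₂) * c′))) * (b + c) + (1 * (2 * ((1 * (1
          * l₁ + l₂) + l₁) * (b′ + c′) + (1 * l₁ + l₂) * b′) + ((1 * (1 * l₁ + l₂) + l₁) * b′ +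
          (1 * l₁ + l₂) * c′)) + ((1 * (1 * l₁ + l₂) + l₁) * (b′ + c′) + (1 * l₁ + l₂) * b′)) *
          b)
    + β * ((1 * (1 * (2 * ((1 * (1 * l₁ + l₂) + l₁) * (b′ + c′) + (1 * l₁ + l₂) * b′) + ((1 * (1
        * l₁ + l₂) + l₁) * b′ + (1 * l₁ + l₂) * c′)) + ((1 * (1 * l₁ + l₂) + l₁) * (b′ + c′) + (1
        * l₁ + l₂) * b′)) + (2 * ((1 * (1 * l₁ + l₂) + l₁) * (b′ + c′) + (1 * l₁ + l₂) * b′) +
        ((1 * (1 * l₁ + l₂) + l₁) * b′ + (1 * l₁ + l₂) * c′))) * b + (1 * (2 * ((1 * (1 * l₁ +
        l₂) + l₁) * (b′ + c′) + (1 * l₁ + l₂) * b′) + ((1 * (1 * l₁ + l₂) + l₁) * b′ + (1 * l₁ +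
        l₂) * c′)) + ((1 * (1 * l₁ + l₂) + l₁) * (b′ + c′) + (1 * l₁ + l₂) * b′)) * c)
    ≡ α * (2 * ((2 * ((2 * l₁ + l₂) * (b + c) + l₁ * b) + ((2 * l₁ + l₂) * b + l₁ * c)) * (b′ +
        c′) + ((2 * l₁ + l₂) * (b + c) + l₁ * b) * b′) + ((2 * ((2 * l₁ + l₂) * (b + c) + l₁ * b)
        + ((2 * l₁ + l₂) * b + l₁ * c)) * b′ + ((2 * l₁ + l₂) * (b + c) + l₁ * b) * c′))
    + β * ((2 * ((2 * l₁ + l₂) * (b + c) + l₁ * b) + ((2 * l₁ + l₂) * b + l₁ * c)) * (b′ + c′) +
        ((2 * l₁ + l₂) * (b + c) + l₁ * b) * b′)
    + 2 * (2 * b + c) * (2 * b′ + c′) * (l₂ * α + (l₁ + l₂) * β)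
  unfolded = solve-∀

M-positive : ∀ W → 1 ≤ M W
M-positive []          = s≤s z≤n
M-positive (x ∷ [])    = s≤s z≤n
M-positive (x ∷ y ∷ w) with f-head x y w
... | c , cs , eq rewrite eq = numAux-positive cs (s≤s z≤n) (s≤s z≤n)

convergentPair-f-positive : ∀ x y w → 1 ≤ proj₂ (convergentPair (f (x ∷ y ∷ w)))
convergentPair-f-positive x y w with f-head x y w
... | c , cs , eq rewrite eq = proj₂-run-positive cs (s≤s z≤n) (s≤s z≤n)

prefix : Word → Pair
prefix S = convergentPair (f (S ++ R ∷ []))

prefix-positive : ∀ x s → 1 ≤ proj₂ (prefix (x ∷ s))
prefix-positive x []      = convergentPair-f-positive x R []
prefix-positive x (y ∷ s) = convergentPair-f-positive x y (s ++ R ∷ [])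

M-split : ∀ S w → M (S ++ R ∷ w) ≡ uncurry (numAux (f (R ∷ w))) (prefix S)
M-split S w = trans (cong numerator (f-++ S R w)) (numAux-++ (f (S ++ R ∷ [])) (f (R ∷ w)) 1 0)

f-middleω : ∀ u r S₂ → f (R ∷ replicate (suc u) U ++ replicate (suc r) R ++ U ∷ S₂)
  ≡ 2 ∷ ones u ++ 2 ∷ ones r ++ 2 ∷ f (U ∷ S₂)
f-middleω u r S₂ = cong (2 ∷_) (trans (f-replicate U u _)
  (cong (λ cs → ones u ++ 2 ∷ cs) (f-replicate R r (U ∷ S₂))))

f-middleω′ : ∀ u r S₂ → f (R ∷ replicate (suc r) R ++ replicate (suc (suc u)) U ++ S₂)
  ≡ ones (suc r) ++ 2 ∷ ones (suc u) ++ f (U ∷ S₂)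
f-middleω′ u r S₂ = trans (f-replicate R (suc r) _)
  (cong (λ cs → ones (suc r) ++ 2 ∷ cs) (f-replicate U (suc u) S₂))

M-ω : ∀ S₁ u r S₂ → M (ω S₁ (suc u) (suc r) S₂)
  ≡ coeffs (f (U ∷ S₂)) · middleω (fibEven u) (fibOdd u) (fibEven r) (fibOdd r) (prefix S₁)
M-ω S₁ u r S₂ = begin
  M (ω S₁ (suc u) (suc r) S₂)
    ≡⟨ M-split S₁ _ ⟩
  uncurry (numAux (f (R ∷ replicate (suc u) U ++ replicate (suc r) R ++ U ∷ S₂))) ℓ
    ≡⟨ cong (λ cs → uncurry (numAux cs) ℓ) (f-middleω u r S₂) ⟩
  uncurry (numAux (2 ∷ ones u ++ 2 ∷ ones r ++ 2 ∷ T)) ℓ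
    ≡⟨ numAux-ones u _ _ _ ⟩
  uncurry (numAux (2 ∷ ones r ++ 2 ∷ T)) (fibBlock u (step 2 ℓ))
    ≡⟨ numAux-ones r _ _ _ ⟩
  uncurry (numAux T) (step 2 (fibBlock r (step 2 (fibBlock u (step 2 ℓ)))))
    ≡⟨ numAux-linear T _ _ ⟩
  coeffs T · middleω (fibEven u) (fibOdd u) (fibEven r) (fibOdd r) ℓ ∎
  where
  open ≡-Reasoning
  ℓ = prefix S₁
  T = f (U ∷ S₂)

M-ω′ : ∀ S₁ u r S₂ → M (ω′ S₁ (suc u) (suc r) S₂)
  ≡ coeffs (f (U ∷ S₂)) · middleω′ (fibEven u) (fibOdd u) (fibEven r) (fibOdd r) (prefix S₁)
M-ω′ S₁ u r S₂ = begin
  M (ω′ S₁ (suc u) (suc r) S₂)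
    ≡⟨ M-split S₁ _ ⟩
  uncurry (numAux (f (R ∷ replicate (suc r) R ++ replicate (suc (suc u)) U ++ S₂))) ℓ
    ≡⟨ cong (λ cs → uncurry (numAux cs) ℓ) (f-middleω′ u r S₂) ⟩
  uncurry (numAux (1 ∷ 1 ∷ ones r ++ 2 ∷ 1 ∷ 1 ∷ ones u ++ T)) ℓ
    ≡⟨ numAux-ones r _ _ _ ⟩
  uncurry (numAux (2 ∷ 1 ∷ 1 ∷ ones u ++ T)) (fibBlock r (step 1 (step 1 ℓ)))
    ≡⟨ numAux-ones u _ _ _ ⟩
  uncurry (numAux T) (fibBlock u (step 1 (step 1 (step 2 (fibBlock r (step 1 (step 1 ℓ)))))))
    ≡⟨ numAux-linear T _ _ ⟩
  coeffs T · middleω′ (fibEven u) (fibOdd u) (fibEven r) (fibOdd r) ℓ ∎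
  where
  open ≡-Reasoning
  ℓ = prefix S₁
  T = f (U ∷ S₂)

excess : ℕ → ℕ → Pair → Pair → ℕ
excess u r (l₁ , l₂) (α , β) = 2 * fibEven (suc u) * fibEven (suc r) * (l₂ * α + (l₁ + l₂) * β)

excess-positive : ∀ u r l κ → 1 ≤ proj₂ l → 1 ≤ proj₁ κ → 1 ≤ excess u r l κ
excess-positive u r l κ l₂≥1 α≥1 =
  *-mono-≤ (*-mono-≤ (*-mono-≤ {1} {2} (s≤s z≤n) (fibEven-suc-positive u)) (fibEven-suc-positive r))
           (≤-trans (*-mono-≤ l₂≥1 α≥1) (m≤m+n _ _))

M-ω′≡M-ω+excess : ∀ S₁ u r S₂ →
  M (ω′ S₁ (suc u) (suc r) S₂)
    ≡ M (ω S₁ (suc u) (suc r) S₂) + excess u r (prefix S₁) (coeffs (f (U ∷ S₂)))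
M-ω′≡M-ω+excess S₁ u r S₂ = begin
  M (ω′ S₁ (suc u) (suc r) S₂)
    ≡⟨ M-ω′ S₁ u r S₂ ⟩
  κ · middleω′ b c b′ c′ ℓ
    ≡⟨ middle-exchange b c b′ c′ (proj₁ κ) (proj₂ κ) (proj₁ ℓ) (proj₂ ℓ) ⟩
  κ · middleω b c b′ c′ ℓ + excess u r ℓ κ
    ≡⟨ cong (_+ excess u r ℓ κ) (sym (M-ω S₁ u r S₂)) ⟩
  M (ω S₁ (suc u) (suc r) S₂) + excess u r ℓ κ ∎
  where
  open ≡-Reasoning
  ℓ = prefix S₁
  κ = coeffs (f (U ∷ S₂))
  b = fibEven u
  c = fibOdd u
  b′ = fibEven r
  c′ = fibOdd r

lemma3p3 : (u r : ℕ) → u ≥ 1 → r ≥ 1 → (S₁ S₂ : Word) →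
    (M (ω S₁ u r S₂) ≤ M (ω′ S₁ u r S₂))
    × (M (ω′ S₁ u r S₂) ≡ M (ω S₁ u r S₂) → (S₁ ≡ [] ⊎ S₁ ≡ U ∷ []))
lemma3p3 (suc u) (suc r) (s≤s z≤n) (s≤s z≤n) S₁ S₂ =
  ≤-trans (m≤m+n _ _) (≤-reflexive (sym (M-ω′≡M-ω+excess S₁ u r S₂))) , equality-case S₁
  where
  equality-case : ∀ S₁ → M (ω′ S₁ (suc u) (suc r) S₂) ≡ M (ω S₁ (suc u) (suc r) S₂) →
                  S₁ ≡ [] ⊎ S₁ ≡ U ∷ []
  equality-case []      _  = inj₁ refl
  equality-case (x ∷ s) eq = ⊥-elim (<-irrefl (trans (sym eq) (M-ω′≡M-ω+excess (x ∷ s) u r S₂))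
    (m<m+n _ (excess-positive u r (prefix (x ∷ s)) (coeffs (f (U ∷ S₂)))
                                (prefix-positive x s) (M-positive (U ∷ S₂)))))
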